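{- For any Leaf-to-Leaf+ CacAP instance $(G,L)$ with root $r$ and leaf set $T$, there exists a matching $M\subseteq L$ on the leaves of $G$ (pairwise disjoint links with all endpoints leaves) containing no bad link such that $$|M|+\tfrac12|M_{\mathrm{in}}|+(|T|-2|M|)\le|H|+\tfrac12|H_{\mathrm{in}}|$$ for every solution $H$ of the instance.
   Context: A cactus is a connected multigraph $G=(V,E)$ in which every edge lies in exactly one cycle (pairs of parallel edges count as cycles). A CacAP instance $(G,L)$: cactus $G$, links $L\subseteq\binom V2$; a solution is $F\subseteq L$ with $(V,E\cup F)$ $3$-edge-connected. Leaves are the degree-$2$ vertices. Leaf-to-Leaf+ with root $r$: every endpoint of every link is $r$ or a leaf. A link is an in-link if both endpoints lie in the same connected component of $G-r$, otherwise a cross-link; $X_{\mathrm{in}}$ is the set of in-links of $X$. Let $\mathcal C=\{C\subseteq V\setminus\{r\}:|\delta_E(C)|=2\}$; a link covers $C$ if exactly one of its endpoints is in $C$. For $C\in\mathcal C$, $T_C$ is the set of leaves in $C$ that are endpoints of links of $L$ covering $C$. A link $\{u,v\}\in L$ is bad if $T_C\subseteq\{u,v\}\subseteq C$ for some $C\in\mathcal C$. -}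

module Defs where

open import Data.Nat using (ℕ; zero; suc; _+_; _*_; _≤_)
open import Data.Bool using (Bool; true; false; _∧_; _∨_; not; _xor_; if_then_else_)
open import Data.Fin using (Fin; zero; suc; inject₁; fromℕ; _≟_)
open import Data.Product using (Σ; _×_; _,_; proj₁; proj₂; ∃)
open import Data.Sum using (_⊎_)
open import Relation.Nullary using (¬_)
open import Relation.Nullary.Decidable using (⌊_⌋)
open import Relation.Binary.PropositionalEquality using (_≡_; _≢_)
open import Function.Definitions using (Injective)

-- A multigraph with m edges is given by
--   ends : Fin m → Fin n × Fin n      (edge e joins proj₁ (ends e), proj₂ (ends e)).
-- A link family is  lk : Fin p → Fin n × Fin n  (link i is {proj₁ (lk i), proj₂ (lk i)}).
-- Subsets of a finite index set are Bool-valued functions.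

_==_ : ∀ {n} → Fin n → Fin n → Bool
x == y = ⌊ x ≟ y ⌋

count : ∀ {m} → (Fin m → Bool) → ℕ
count {zero}  f = 0
count {suc m} f = (if f zero then 1 else 0) + count (λ i → f (suc i))

anyFin : ∀ {m} → (Fin m → Bool) → Bool
anyFin {zero}  f = false
anyFin {suc m} f = f zero ∨ anyFin (λ i → f (suc i))

Joins : ∀ {n} → Fin n × Fin n → Fin n → Fin n → Set
Joins (a , b) x y = (a ≡ x × b ≡ y) ⊎ (a ≡ y × b ≡ x)

isEnd : ∀ {n} → Fin n × Fin n → Fin n → Bool
isEnd (a , b) v = (a == v) ∨ (b == v)

crosses : ∀ {n} → (Fin n → Bool) → Fin n × Fin n → Bool
crosses C (a , b) = C a xor C b

-- Walks and connectivity.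
-- reach allowed k u v = true  iff there is a walk from u to v of length ≤ k
-- using only edges e with allowed e = true.
reach : ∀ {n m} → (Fin m → Fin n × Fin n) → (Fin m → Bool) → ℕ → Fin n → Fin n → Bool
reach ends allowed zero    u v = u == v
reach ends allowed (suc k) u v =
  reach ends allowed k u v ∨
  anyFin (λ e → allowed e ∧
     ((reach ends allowed k u (proj₁ (ends e)) ∧ (proj₂ (ends e) == v)) ∨
      (reach ends allowed k u (proj₂ (ends e)) ∧ (proj₁ (ends e) == v))))

-- connected: any two vertices are joined by a walk (length ≤ n suffices)
Connected : ∀ {n m} → (Fin m → Fin n × Fin n) → Set
Connected {n} ends = ∀ u v → reach ends (λ _ → true) n u v ≡ true

Loopless : ∀ {n m} → (Fin m → Fin n × Fin n) → Set
Loopless ends = ∀ e → proj₁ (ends e) ≢ proj₂ (ends e)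

-- A cycle of length suc K (K ≥ 1) : distinct vertices vs 0 … vs K and distinct
-- edges es 0 … es K, edge es i joining vs i and vs (i+1), es K joining vs K and vs 0.
-- (K = 1 gives a pair of parallel edges.)
record Cycle {n m : ℕ} (ends : Fin m → Fin n × Fin n) : Set where
  field
    K      : ℕ
    K≥1    : 1 ≤ K
    vs     : Fin (suc K) → Fin n
    es     : Fin (suc K) → Fin m
    vs-inj : Injective _≡_ _≡_ vs
    es-inj : Injective _≡_ _≡_ es
    step   : ∀ (i : Fin K) → Joins (ends (es (inject₁ i))) (vs (inject₁ i)) (vs (suc i))
    close  : Joins (ends (es (fromℕ K))) (vs (fromℕ K)) (vs zero)

_∈Cyc_ : ∀ {n m} {ends : Fin m → Fin n × Fin n} → Fin m → Cycle ends → Set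
e ∈Cyc c = ∃ λ i → Cycle.es c i ≡ e

-- cactus: connected (loopless) multigraph, every edge in exactly one cycle
-- (cycles identified with their edge sets)
IsCactus : ∀ {n m} → (Fin m → Fin n × Fin n) → Set
IsCactus {n} {m} ends =
  Connected ends × Loopless ends ×
  (∀ (e : Fin m) →
     (Σ (Cycle ends) λ c → e ∈Cyc c) ×
     (∀ (c c' : Cycle ends) → e ∈Cyc c → e ∈Cyc c' →
        ∀ f → (f ∈Cyc c → f ∈Cyc c') × (f ∈Cyc c' → f ∈Cyc c)))

deg : ∀ {n m} → (Fin m → Fin n × Fin n) → Fin n → ℕ
deg ends v = count (λ e → isEnd (ends e) v)

isLeaf : ∀ {n m} → (Fin m → Fin n × Fin n) → Fin n → Bool
isLeaf ends v = ⌊ Data.Nat._≟_ (deg ends v) 2 ⌋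

numLeaves : ∀ {n m} → (Fin m → Fin n × Fin n) → ℕ
numLeaves ends = count (isLeaf ends)

-- Links: L ⊆ (V choose 2), i.e. each link has two distinct endpoints and
-- distinct indices give distinct unordered pairs.
IsLinkSet : ∀ {n p} → (Fin p → Fin n × Fin n) → Set
IsLinkSet lk =
  (∀ i → proj₁ (lk i) ≢ proj₂ (lk i)) ×
  (∀ i j → Joins (lk i) (proj₁ (lk j)) (proj₂ (lk j)) → i ≡ j)

LeafToLeafPlus : ∀ {n m p} → (Fin m → Fin n × Fin n) → (Fin p → Fin n × Fin n) → Fin n → Set
LeafToLeafPlus ends lk r =
  ∀ i → (proj₁ (lk i) ≡ r ⊎ isLeaf ends (proj₁ (lk i)) ≡ true) ×
        (proj₂ (lk i) ≡ r ⊎ isLeaf ends (proj₂ (lk i)) ≡ true)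

cutE : ∀ {n m} → (Fin m → Fin n × Fin n) → (Fin n → Bool) → ℕ
cutE ends C = count (λ e → crosses C (ends e))

cutL : ∀ {n p} → (Fin p → Fin n × Fin n) → (Fin p → Bool) → (Fin n → Bool) → ℕ
cutL lk F C = count (λ i → F i ∧ crosses C (lk i))

-- F ⊆ L is a solution: (V, E ∪ F) is 3-edge-connected, i.e. every cut
-- δ(S), ∅ ≠ S ≠ V, contains at least 3 edges of E ∪ F.
IsSolution : ∀ {n m p} → (Fin m → Fin n × Fin n) → (Fin p → Fin n × Fin n) → (Fin p → Bool) → Set
IsSolution {n} ends lk F =
  ∀ (S : Fin n → Bool) → (∃ λ v → S v ≡ true) → (∃ λ v → S v ≡ false) →
    3 ≤ cutE ends S + cutL lk F S

-- in-links: both endpoints lie in the same connected component of G - r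
avoids : ∀ {n m} → (Fin m → Fin n × Fin n) → Fin n → Fin m → Bool
avoids ends r e = not (isEnd (ends e) r)

isInLink : ∀ {n m p} → (Fin m → Fin n × Fin n) → (Fin p → Fin n × Fin n) → Fin n → Fin p → Bool
isInLink {n} ends lk r i =
  not (proj₁ (lk i) == r) ∧ not (proj₂ (lk i) == r) ∧
  reach ends (avoids ends r) n (proj₁ (lk i)) (proj₂ (lk i))

numIn : ∀ {n m p} → (Fin m → Fin n × Fin n) → (Fin p → Fin n × Fin n) → Fin n → (Fin p → Bool) → ℕ
numIn ends lk r X = count (λ i → X i ∧ isInLink ends lk r i)

IsLeafMatching : ∀ {n m p} → (Fin m → Fin n × Fin n) → (Fin p → Fin n × Fin n) → (Fin p → Bool) → Set
IsLeafMatching ends lk M =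
  (∀ i → M i ≡ true →
     isLeaf ends (proj₁ (lk i)) ≡ true × isLeaf ends (proj₂ (lk i)) ≡ true) ×
  (∀ i j → M i ≡ true → M j ≡ true → i ≢ j → ∀ v →
     isEnd (lk i) v ≡ true → isEnd (lk j) v ≡ false)

InCalC : ∀ {n m} → (Fin m → Fin n × Fin n) → Fin n → (Fin n → Bool) → Set
InCalC ends r C = C r ≡ false × cutE ends C ≡ 2

InTC : ∀ {n m p} → (Fin m → Fin n × Fin n) → (Fin p → Fin n × Fin n) → (Fin n → Bool) → Fin n → Set
InTC ends lk C w =
  isLeaf ends w ≡ true × C w ≡ true ×
  (∃ λ j → crosses C (lk j) ≡ true × isEnd (lk j) w ≡ true)

IsBad : ∀ {n m p} → (Fin m → Fin n × Fin n) → (Fin p → Fin n × Fin n) → Fin n → Fin p → Set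
IsBad {n} ends lk r i =
  Σ (Fin n → Bool) λ C → InCalC ends r C ×
    (∀ w → InTC ends lk C w → w ≡ proj₁ (lk i) ⊎ w ≡ proj₂ (lk i)) ×
    C (proj₁ (lk i)) ≡ true × C (proj₂ (lk i)) ≡ true

-- Let M be a good matching (a leaf matching without bad links) maximising 2|M| - |M_in|.
-- Given a solution H, let M′ be a largest good matching inside H and let every leaf collect
-- 2 units from the links of H at it: a leaf matched by M′ takes 2 from its M′-link, an
-- unmatched leaf takes 2 from its only H-link or 1 from each of two of them (H covers every
-- leaf, which is cut off by its two cactus edges). An M′-link then pays 4 and any other link
-- of H at most 2, unless both its ends are unmatched leaves. In that case maximality of M′
-- makes the link bad, so it is an in-link (each side of a 2-cut avoiding r is connected in
-- G - r) and one of its ends has a second H-link (a link of H crosses the 2-cut witnessing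
-- badness), so it pays at most 3. Summing over links,
--   2|T| ≤ 2|H| + |H_in| + 2|M′| - |M′_in| ≤ 2|H| + |H_in| + 2|M| - |M_in|.
-- Beyond looplessness, the cactus structure is used only through one fact: every nontrivial
-- cut has at least two edges, since a cycle crosses a cut an even number of times.

module Submission where

open import Defs
open import Algebra.Bundles using (CommutativeRing)
open import Data.Bool using (Bool; true; false; _∧_; _∨_; not; _xor_; if_then_else_)
open import Data.Bool.Properties using (T-≡; T-not-≡; ¬-not; ∧-conicalˡ; ∧-conicalʳ; xor-comm; xor-∧-commutativeRing)
import Data.Bool.Properties as Bool
open import Data.Empty using (⊥-elim)
open import Data.Fin using (Fin; zero; suc; inject₁; fromℕ; punchIn; punchOut; _≟_)
open import Data.Fin.Properties using (any?; all?; ¬∀⟶∃¬; punchInᵢ≢i; punchIn-punchOut; suc-injective)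
open import Data.Nat using (ℕ; zero; suc; _+_; _*_; _≤_; _<_; z≤n; s≤s)
import Data.Nat as ℕ
open import Data.Nat.Properties hiding (_≟_; suc-injective)
open import Data.Nat.Tactic.RingSolver using (solve-∀)
open import Data.Product using (Σ; _×_; _,_; proj₁; proj₂; ∃; ∃₂)
open import Data.Sum using (_⊎_; inj₁; inj₂; [_,_])
import Data.Sum as Sum
open import Data.Vec.Functional using (_∷_; tail)
open import Function using (_∘_; Equivalence)
open import Relation.Binary.PropositionalEquality
  using (_≡_; _≢_; _≗_; refl; sym; trans; cong; cong₂; subst; subst₂; module ≡-Reasoning)
open import Relation.Nullary using (¬_; Dec; yes; no; ¬?; _×-dec_; _⊎-dec_; _→-dec_; contradiction)
open import Relation.Nullary.Decidable using (⌊_⌋; toWitness; fromWitness; toWitnessFalse; fromWitnessFalse; ⌊⌋-map′)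
import Relation.Unary as U

open import Algebra.Properties.Semiring.Sum +-*-semiring
  using (sum; sum-replicate-zero; sum-cong-≗; sum-remove; ∑-distrib-+; ∑-comm; *-distribˡ-sum)
open import Algebra.Properties.CommutativeMonoid.Sum (CommutativeRing.+-commutativeMonoid xor-∧-commutativeRing)
  using () renaming (sum to parity; sum-cong-≗ to parity-cong; sum-remove to parity-remove; sum-init-last to parity-init-last)

private variable
  k : ℕ

∨-introˡ : ∀ {a} b → a ≡ true → a ∨ b ≡ true
∨-introˡ b refl = refl

∨-introʳ : ∀ a {b} → b ≡ true → a ∨ b ≡ true
∨-introʳ true  _ = refl
∨-introʳ false e = e

∨-true : ∀ a b → a ∨ b ≡ true → a ≡ true ⊎ b ≡ true
∨-true true  b _ = inj₁ refl
∨-true false b e = inj₂ e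

∧-intro : ∀ {a b} → a ≡ true → b ≡ true → a ∧ b ≡ true
∧-intro refl refl = refl

xor-true : ∀ a b → a xor b ≡ true → (a ≡ true × b ≡ false) ⊎ (a ≡ false × b ≡ true)
xor-true true  false _ = inj₁ (refl , refl)
xor-true false true  _ = inj₂ (refl , refl)

true⇔true⇒≡ : ∀ {a b} → (a ≡ true → b ≡ true) → (b ≡ true → a ≡ true) → a ≡ b
true⇔true⇒≡ {true}  a⇒b b⇒a = sym (a⇒b refl)
true⇔true⇒≡ {false} {false} a⇒b b⇒a = refl
true⇔true⇒≡ {false} {true}  a⇒b b⇒a = b⇒a refl

xor⇒∨ : ∀ a b → a xor b ≡ true → a ∨ b ≡ true
xor⇒∨ true  b _ = refl
xor⇒∨ false b e = e

xor≡∨ : ∀ a b → ¬ (a ≡ true × b ≡ true) → a xor b ≡ a ∨ b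
xor≡∨ true  true  both = contradiction (refl , refl) both
xor≡∨ true  false _    = refl
xor≡∨ false b     _    = refl

xor-cancel-middle : ∀ a b c → (a xor b) xor (b xor c) ≡ a xor c
xor-cancel-middle a b c = begin
  (a xor b) xor (b xor c) ≡⟨ Bool.xor-assoc a b (b xor c) ⟩
  a xor (b xor (b xor c)) ≡⟨ cong (a xor_) (sym (Bool.xor-assoc b b c)) ⟩
  a xor ((b xor b) xor c) ≡⟨ cong (λ x → a xor (x xor c)) (Bool.xor-same b) ⟩
  a xor c                 ∎
  where open ≡-Reasoning

anyFin-intro : (f : Fin k → Bool) {i : Fin k} → f i ≡ true → anyFin f ≡ true
anyFin-intro f {zero}  fi = ∨-introˡ _ fi
anyFin-intro f {suc i} fi = ∨-introʳ (f zero) (anyFin-intro (f ∘ suc) fi)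

anyFin⇒∃ : (f : Fin k → Bool) → anyFin f ≡ true → ∃ λ i → f i ≡ true
anyFin⇒∃ {suc k} f any with ∨-true (f zero) _ any
... | inj₁ f₀ = zero , f₀
... | inj₂ any′ = let i , fi = anyFin⇒∃ (f ∘ suc) any′ in suc i , fi

anyFin-cong : {f g : Fin k → Bool} → f ≗ g → anyFin f ≡ anyFin g
anyFin-cong {zero}  f≗g = refl
anyFin-cong {suc k} f≗g = cong₂ _∨_ (f≗g zero) (anyFin-cong (f≗g ∘ suc))

isYes⇒ : ∀ {a} {A : Set a} (a? : Dec A) → ⌊ a? ⌋ ≡ true → A
isYes⇒ a? e = toWitness {a? = a?} (Equivalence.from T-≡ e)

isYes⇐ : ∀ {a} {A : Set a} (a? : Dec A) → A → ⌊ a? ⌋ ≡ true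
isYes⇐ a? x = Equivalence.to T-≡ (fromWitness {a? = a?} x)

isNo⇒ : ∀ {a} {A : Set a} (a? : Dec A) → ⌊ a? ⌋ ≡ false → ¬ A
isNo⇒ a? e = toWitnessFalse {a? = a?} (Equivalence.from T-not-≡ e)

isNo⇐ : ∀ {a} {A : Set a} (a? : Dec A) → ¬ A → ⌊ a? ⌋ ≡ false
isNo⇐ a? ¬x = Equivalence.to T-not-≡ (fromWitnessFalse {a? = a?} ¬x)

==⇒≡ : ∀ {n} {a b : Fin n} → (a == b) ≡ true → a ≡ b
==⇒≡ {a = a} {b} = isYes⇒ (a ≟ b)

==-refl : ∀ {n} (a : Fin n) → (a == a) ≡ true
==-refl a = isYes⇐ (a ≟ a) refl

suc-==-suc : ∀ {n} (a b : Fin n) → (suc a == suc b) ≡ (a == b)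
suc-==-suc a b = ⌊⌋-map′ (cong suc) suc-injective (a ≟ b)

𝟙 : Bool → ℕ
𝟙 b = if b then 1 else 0

𝟙≤1 : ∀ b → 𝟙 b ≤ 1
𝟙≤1 true  = ≤-refl
𝟙≤1 false = z≤n

𝟙-mono : ∀ {a b} → (a ≡ true → b ≡ true) → 𝟙 a ≤ 𝟙 b
𝟙-mono {false} _ = z≤n
𝟙-mono {true}  h rewrite h refl = ≤-refl

𝟙-split : ∀ a b → 𝟙 a ≡ 𝟙 (a ∧ b) + 𝟙 (a ∧ not b)
𝟙-split true  true  = refl
𝟙-split true  false = refl
𝟙-split false b     = refl

_⊆_ : (Fin k → Bool) → (Fin k → Bool) → Set
f ⊆ g = ∀ i → f i ≡ true → g i ≡ true

∑-mono : (f g : Fin k → ℕ) → (∀ i → f i ≤ g i) → sum f ≤ sum g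
∑-mono {zero}  f g f≤g = z≤n
∑-mono {suc k} f g f≤g = +-mono-≤ (f≤g zero) (∑-mono (f ∘ suc) (g ∘ suc) (f≤g ∘ suc))

∑-term : (t : Fin k → ℕ) (i : Fin k) → t i ≤ sum t
∑-term {suc k} t i = ≤-trans (m≤m+n (t i) _) (≤-reflexive (sym (sum-remove t)))

∑-two-terms : (t : Fin k → ℕ) {i j : Fin k} → i ≢ j → t i + t j ≤ sum t
∑-two-terms {suc k} t {i} {j} i≢j = begin
  t i + t j                          ≡⟨ cong (λ x → t i + t x) (punchIn-punchOut i≢j) ⟨
  t i + t (punchIn i (punchOut i≢j)) ≤⟨ +-monoʳ-≤ (t i) (∑-term (t ∘ punchIn i) (punchOut i≢j)) ⟩
  t i + sum (t ∘ punchIn i)          ≡⟨ sum-remove t ⟨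
  sum t                              ∎
  where open ≤-Reasoning

count≡∑ : (f : Fin k → Bool) → count f ≡ sum (𝟙 ∘ f)
count≡∑ {zero}  f = refl
count≡∑ {suc k} f = cong (𝟙 (f zero) +_) (count≡∑ (f ∘ suc))

count-cong : {f g : Fin k → Bool} → f ≗ g → count f ≡ count g
count-cong {f = f} {g} f≗g =
  trans (count≡∑ f) (trans (sum-cong-≗ (cong 𝟙 ∘ f≗g)) (sym (count≡∑ g)))

count≤ : (f : Fin k → Bool) → count f ≤ k
count≤ {zero}  f = z≤n
count≤ {suc k} f with f zero
... | true  = s≤s (count≤ (f ∘ suc))
... | false = m≤n⇒m≤1+n (count≤ (f ∘ suc))

count-mono : {f g : Fin k → Bool} → f ⊆ g → count f ≤ count g
count-mono {f = f} {g} f⊆g =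
  subst₂ _≤_ (sym (count≡∑ f)) (sym (count≡∑ g)) (∑-mono _ _ (λ i → 𝟙-mono (f⊆g i)))

count-remove : (f : Fin (suc k) → Bool) (i : Fin (suc k)) → count f ≡ 𝟙 (f i) + count (f ∘ punchIn i)
count-remove f i = trans (count≡∑ f)
  (trans (sum-remove {i = i} (𝟙 ∘ f)) (cong (𝟙 (f i) +_) (sym (count≡∑ (f ∘ punchIn i)))))

count-pos : (f : Fin k → Bool) {i : Fin k} → f i ≡ true → 1 ≤ count f
count-pos f {i} fi = subst₂ _≤_ (cong 𝟙 fi) (sym (count≡∑ f)) (∑-term (𝟙 ∘ f) i)

count-mono-< : {f g : Fin k → Bool} → f ⊆ g → (i : Fin k) → f i ≡ false → g i ≡ true → count f < count g
count-mono-< {suc k} {f} {g} f⊆g i fi gi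
  rewrite count-remove f i | count-remove g i | fi | gi = s≤s (count-mono (f⊆g ∘ punchIn i))

count≥2 : (f : Fin k → Bool) {i j : Fin k} → i ≢ j → f i ≡ true → f j ≡ true → 2 ≤ count f
count≥2 f {i} {j} i≢j fi fj =
  subst₂ _≤_ (cong₂ _+_ (cong 𝟙 fi) (cong 𝟙 fj)) (sym (count≡∑ f)) (∑-two-terms (𝟙 ∘ f) i≢j)

count-pos⇒∃ : (f : Fin k → Bool) → 1 ≤ count f → ∃ λ i → f i ≡ true
count-pos⇒∃ {suc k} f pos with f zero in eq
... | true  = zero , eq
... | false = let i , fi = count-pos⇒∃ (f ∘ suc) pos in suc i , fi

count≥2⇒∃≢ : (f : Fin k → Bool) → 2 ≤ count f → (i : Fin k) → ∃ λ j → j ≢ i × f j ≡ true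
count≥2⇒∃≢ {suc k} f two i = punchIn i j , punchInᵢ≢i i j , fj
  where
  rest-pos : 1 ≤ count (f ∘ punchIn i)
  rest-pos = +-cancelˡ-≤ 1 1 _ (≤-trans (subst (2 ≤_) (count-remove f i) two) (+-monoˡ-≤ _ (𝟙≤1 (f i))))
  j = proj₁ (count-pos⇒∃ (f ∘ punchIn i) rest-pos)
  fj = proj₂ (count-pos⇒∃ (f ∘ punchIn i) rest-pos)

count-split : (f g : Fin k → Bool) → count f ≡ count (λ i → f i ∧ g i) + count (λ i → f i ∧ not (g i))
count-split f g = begin
  count f
    ≡⟨ count≡∑ f ⟩
  sum (λ i → 𝟙 (f i))
    ≡⟨ sum-cong-≗ (λ i → 𝟙-split (f i) (g i)) ⟩
  sum (λ i → 𝟙 (f i ∧ g i) + 𝟙 (f i ∧ not (g i)))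
    ≡⟨ ∑-distrib-+ (λ i → 𝟙 (f i ∧ g i)) (λ i → 𝟙 (f i ∧ not (g i))) ⟩
  sum (λ i → 𝟙 (f i ∧ g i)) + sum (λ i → 𝟙 (f i ∧ not (g i)))
    ≡⟨ cong₂ _+_ (count≡∑ (λ i → f i ∧ g i)) (count≡∑ (λ i → f i ∧ not (g i))) ⟨
  count (λ i → f i ∧ g i) + count (λ i → f i ∧ not (g i))
    ∎
  where open ≡-Reasoning

if-∨-≤ : ∀ p q y → (if p ∨ q then y else 0) ≤ (if p then y else 0) + (if q then y else 0)
if-∨-≤ true  q     y = m≤m+n y _
if-∨-≤ false true  y = ≤-refl
if-∨-≤ false false y = z≤n

∑-δ : (a : Fin k) (x : Fin k → ℕ) → sum (λ t → if a == t then x t else 0) ≡ x a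
∑-δ {suc k} zero    x = trans (cong (x zero +_) (sum-replicate-zero k)) (+-identityʳ (x zero))
∑-δ {suc k} (suc a) x =
  trans (sum-cong-≗ (λ t → cong (λ b → if b then x (suc t) else 0) (suc-==-suc a t))) (∑-δ a (x ∘ suc))

∑-endpoints : (a b : Fin k) (x : Fin k → ℕ) → sum (λ t → if isEnd (a , b) t then x t else 0) ≤ x a + x b
∑-endpoints a b x = begin
  sum (λ t → if isEnd (a , b) t then x t else 0)
    ≤⟨ ∑-mono _ _ (λ t → if-∨-≤ (a == t) (b == t) (x t)) ⟩
  sum (λ t → (if a == t then x t else 0) + (if b == t then x t else 0))
    ≡⟨ ∑-distrib-+ (λ t → if a == t then x t else 0) _ ⟩
  sum (λ t → if a == t then x t else 0) + sum (λ t → if b == t then x t else 0)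
    ≡⟨ cong₂ _+_ (∑-δ a x) (∑-δ b x) ⟩
  x a + x b
    ∎
  where open ≤-Reasoning

-- Maximisation over subsets of a finite set

Maximum : {A : Set} → (A → Set) → (A → ℕ) → Set
Maximum {A} P w = Σ A λ x → P x × (∀ y → P y → w y ≤ w x)

MaximumOrEmpty : {A : Set} → (A → Set) → (A → ℕ) → Set
MaximumOrEmpty P w = Maximum P w ⊎ (∀ x → ¬ P x)

maximum-⊎ : {A : Set} {P P₁ P₂ : A → Set} {w : A → ℕ} →
  (∀ x → P x → P₁ x ⊎ P₂ x) → (∀ {x} → P₁ x → P x) → (∀ {x} → P₂ x → P x) →
  MaximumOrEmpty P₁ w → MaximumOrEmpty P₂ w → MaximumOrEmpty P w
maximum-⊎ split in₁ in₂ (inj₂ ¬P₁) (inj₂ ¬P₂) = inj₂ λ x p → [ ¬P₁ x , ¬P₂ x ] (split x p)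
maximum-⊎ split in₁ in₂ (inj₁ (x₁ , p₁ , max₁)) (inj₂ ¬P₂) =
  inj₁ (x₁ , in₁ p₁ , λ y p → [ max₁ y , ⊥-elim ∘ ¬P₂ y ] (split y p))
maximum-⊎ split in₁ in₂ (inj₂ ¬P₁) (inj₁ (x₂ , p₂ , max₂)) =
  inj₁ (x₂ , in₂ p₂ , λ y p → [ ⊥-elim ∘ ¬P₁ y , max₂ y ] (split y p))
maximum-⊎ {w = w} split in₁ in₂ (inj₁ (x₁ , p₁ , max₁)) (inj₁ (x₂ , p₂ , max₂)) with ≤-total (w x₁) (w x₂)
... | inj₁ w₁≤w₂ =
  inj₁ (x₂ , in₂ p₂ , λ y p → [ (λ q → ≤-trans (max₁ y q) w₁≤w₂) , max₂ y ] (split y p))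
... | inj₂ w₂≤w₁ =
  inj₁ (x₁ , in₁ p₁ , λ y p → [ max₁ y , (λ q → ≤-trans (max₂ y q) w₂≤w₁) ] (split y p))

Respects≗ : ((Fin k → Bool) → Set) → Set
Respects≗ P = ∀ {f g} → f ≗ g → P f → P g

Invariant≗ : ((Fin k → Bool) → ℕ) → Set
Invariant≗ w = ∀ {f g} → f ≗ g → w f ≡ w g

∷-cong : ∀ b {f g : Fin k → Bool} → f ≗ g → b ∷ f ≗ b ∷ g
∷-cong b f≗g zero    = refl
∷-cong b f≗g (suc i) = f≗g i

head∷tail : ∀ {b} (f : Fin (suc k) → Bool) → f zero ≡ b → f ≗ b ∷ tail f
head∷tail f f₀ zero    = f₀
head∷tail f f₀ (suc i) = refl

maximum-head : {P : (Fin (suc k) → Bool) → Set} {w : (Fin (suc k) → Bool) → ℕ} →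
  Respects≗ P → Invariant≗ w → (b : Bool) →
  MaximumOrEmpty (P ∘ (b ∷_)) (w ∘ (b ∷_)) → MaximumOrEmpty (λ f → f zero ≡ b × P f) w
maximum-head P-resp w-inv b (inj₁ (g , pg , max)) = inj₁ (b ∷ g , (refl , pg) , λ f (f₀ , pf) →
  ≤-trans (≤-reflexive (w-inv (head∷tail f f₀))) (max (tail f) (P-resp (head∷tail f f₀) pf)))
maximum-head P-resp w-inv b (inj₂ ¬P) = inj₂ λ f (f₀ , pf) → ¬P (tail f) (P-resp (head∷tail f f₀) pf)

maximum : {P : (Fin k → Bool) → Set} → Respects≗ P → U.Decidable P →
  (w : (Fin k → Bool) → ℕ) → Invariant≗ w → MaximumOrEmpty P w
maximum {zero} P-resp P? w w-inv with P? (λ ())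
... | yes p = inj₁ ((λ ()) , p , λ g _ → ≤-reflexive (w-inv (λ ())))
... | no ¬p = inj₂ λ f pf → ¬p (P-resp (λ ()) pf)
maximum {suc k} {P} P-resp P? w w-inv = maximum-⊎ head-cases proj₂ proj₂ (branch false) (branch true)
  where
  branch : ∀ b → MaximumOrEmpty (λ f → f zero ≡ b × P f) w
  branch b = maximum-head P-resp w-inv b
    (maximum (P-resp ∘ ∷-cong b) (P? ∘ (b ∷_)) (w ∘ (b ∷_)) (w-inv ∘ ∷-cong b))
  head-cases : ∀ f → P f → (f zero ≡ false × P f) ⊎ (f zero ≡ true × P f)
  head-cases f p with f zero
  ... | false = inj₁ (refl , p)
  ... | true  = inj₂ (refl , p)

∃? : {P : (Fin k → Bool) → Set} → Respects≗ P → U.Decidable P → Dec (∃ P)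
∃? P-resp P? with maximum P-resp P? (λ _ → 0) (λ _ → refl)
... | inj₁ (f , p , _) = yes (f , p)
... | inj₂ ¬P          = no λ (f , p) → ¬P f p

-- Reachability

chain-stabilises : {n : ℕ} (S : ℕ → Fin n → Bool) → (∀ j → S j ⊆ S (suc j)) →
  (∀ i j → S i ≗ S j → S (suc i) ≗ S (suc j)) → S (suc n) ⊆ S n
chain-stabilises {n} S grows determined x Sx =
  [ (λ stable → trans (sym (stable x)) Sx) , (λ large → contradiction (≤-trans large (count≤ (S (suc n)))) (n≮n n)) ]
    (stable-or-large n)
  where
  strict : ∀ j → ¬ S (suc j) ≗ S j → count (S j) < count (S (suc j))
  strict j unstable with ¬∀⟶∃¬ n _ (λ x → S (suc j) x Bool.≟ S j x) unstable
  ... | x , Sx≢ with S j x in e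
  ... | true  = contradiction (grows j x e) Sx≢
  ... | false = count-mono-< (grows j) x e (¬-not Sx≢)
  stable-or-large : ∀ j → S (suc j) ≗ S j ⊎ suc j ≤ count (S (suc j))
  stable-or-large j with all? (λ x → S (suc j) x Bool.≟ S j x)
  ... | yes stable = inj₁ stable
  stable-or-large zero    | no unstable = inj₂ (≤-trans (s≤s z≤n) (strict zero unstable))
  stable-or-large (suc j) | no unstable with stable-or-large j
  ... | inj₁ stable = contradiction (determined (suc j) j stable) unstable
  ... | inj₂ large  = inj₂ (≤-trans (s≤s large) (strict (suc j) unstable))

crosses-Joins : ∀ {n} (S : Fin n → Bool) {p : Fin n × Fin n} {x y} → Joins p x y → crosses S p ≡ S x xor S y
crosses-Joins S (inj₁ (refl , refl)) = refl
crosses-Joins S (inj₂ (refl , refl)) = xor-comm (S _) (S _)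

module Reachability {n m : ℕ} (ends : Fin m → Fin n × Fin n) (allowed : Fin m → Bool) where

  private
    R : ℕ → Fin n → Fin n → Bool
    R = reach ends allowed

  reach-refl : ∀ k u → R k u u ≡ true
  reach-refl zero    u = ==-refl u
  reach-refl (suc k) u = ∨-introˡ _ (reach-refl k u)

  reach-step : ∀ {k u a b} e → R k u a ≡ true → allowed e ≡ true → Joins (ends e) a b → R (suc k) u b ≡ true
  reach-step e r ae (inj₁ (refl , refl)) =
    ∨-introʳ _ (anyFin-intro _ {e} (∧-intro ae (∨-introˡ _ (∧-intro r (==-refl _)))))
  reach-step e r ae (inj₂ (refl , refl)) =
    ∨-introʳ _ (anyFin-intro _ {e} (∧-intro ae (∨-introʳ _ (∧-intro r (==-refl _)))))

  reach-suc⁻¹ : ∀ k {u v} → R (suc k) u v ≡ true →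
    R k u v ≡ true ⊎ ∃₂ λ e a → allowed e ≡ true × Joins (ends e) a v × R k u a ≡ true
  reach-suc⁻¹ k r with ∨-true _ _ r
  ... | inj₁ r′ = inj₁ r′
  ... | inj₂ any with anyFin⇒∃ _ any
  ... | e , s with ∨-true _ _ (∧-conicalʳ _ _ s)
  ... | inj₁ fwd = inj₂ (e , _ , ∧-conicalˡ _ _ s , inj₁ (refl , ==⇒≡ (∧-conicalʳ _ _ fwd)) , ∧-conicalˡ _ _ fwd)
  ... | inj₂ bwd = inj₂ (e , _ , ∧-conicalˡ _ _ s , inj₂ (==⇒≡ (∧-conicalʳ _ _ bwd) , refl) , ∧-conicalˡ _ _ bwd)

  reach-crossing : ∀ k {u v} (S : Fin n → Bool) → R k u v ≡ true → S u ≡ true → S v ≡ false →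
    ∃ λ e → allowed e ≡ true × crosses S (ends e) ≡ true
  reach-crossing zero S r Su Sv with ==⇒≡ r
  ... | refl = contradiction (trans (sym Su) Sv) λ ()
  reach-crossing (suc k) S r Su Sv with reach-suc⁻¹ k r
  ... | inj₁ r′ = reach-crossing k S r′ Su Sv
  ... | inj₂ (e , a , ae , joins , r′) with S a in Sa
  ... | true  = e , ae , trans (crosses-Joins S joins) (cong₂ _xor_ Sa Sv)
  ... | false = reach-crossing k S r′ Su Sa

  reach-cong : ∀ {j k u} → (∀ x → R j u x ≡ R k u x) → ∀ v → R (suc j) u v ≡ R (suc k) u v
  reach-cong h v = cong₂ _∨_ (h v) (anyFin-cong λ e →
    cong (allowed e ∧_) (cong₂ _∨_ (cong (_∧ _) (h _)) (cong (_∧ _) (h _))))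

  reach-closed : ∀ {u a b} e → R n u a ≡ true → allowed e ≡ true → Joins (ends e) a b → R n u b ≡ true
  reach-closed {u} e r ae joins =
    chain-stabilises (λ k → R k u) (λ k x → ∨-introˡ _) (λ i j → reach-cong {i} {j}) _
      (reach-step {n} {u} e r ae joins)

-- Cuts in a cactus

parity-true⇒∃ : (f : Fin k → Bool) → parity f ≡ true → ∃ λ i → f i ≡ true
parity-true⇒∃ {suc k} f odd with f zero in f₀
... | true  = zero , f₀
... | false = let i , fi = parity-true⇒∃ (f ∘ suc) odd in suc i , fi

parity-other : (f : Fin (suc k) → Bool) → parity f ≡ false → ∀ i → f i ≡ true → ∃ λ j → j ≢ i × f j ≡ true
parity-other f even i fi = punchIn i j , punchInᵢ≢i i j , fj
  where
  rest-odd : parity (f ∘ punchIn i) ≡ true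
  rest-odd = Bool.not-injective
    (subst (λ b → b xor parity (f ∘ punchIn i) ≡ false) fi (trans (sym (parity-remove f)) even))
  j = proj₁ (parity-true⇒∃ (f ∘ punchIn i) rest-odd)
  fj = proj₂ (parity-true⇒∃ (f ∘ punchIn i) rest-odd)

parity-telescope : ∀ K (b : Fin (suc K) → Bool) → parity (λ i → b (inject₁ i) xor b (suc i)) ≡ b zero xor b (fromℕ K)
parity-telescope zero    b = sym (Bool.xor-same (b zero))
parity-telescope (suc K) b =
  trans (cong ((b zero xor b (suc zero)) xor_) (parity-telescope K (b ∘ suc)))
        (xor-cancel-middle (b zero) (b (suc zero)) (b (fromℕ (suc K))))

cycle-crossings-even : ∀ {n m} {ends : Fin m → Fin n × Fin n} (c : Cycle ends) (S : Fin n → Bool) →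
  parity (λ j → crosses S (ends (Cycle.es c j))) ≡ false
cycle-crossings-even {ends = ends} c S = begin
  parity (λ j → crosses S (ends (es j)))
    ≡⟨ parity-init-last (λ j → crosses S (ends (es j))) ⟩
  parity (λ i → crosses S (ends (es (inject₁ i)))) xor crosses S (ends (es (fromℕ K)))
    ≡⟨ cong₂ _xor_ (trans (parity-cong (λ i → crosses-Joins S (step i))) (parity-telescope K b))
                   (crosses-Joins S close) ⟩
  (b zero xor b (fromℕ K)) xor (b (fromℕ K) xor b zero)
    ≡⟨ xor-cancel-middle (b zero) (b (fromℕ K)) (b zero) ⟩
  b zero xor b zero
    ≡⟨ Bool.xor-same (b zero) ⟩
  false ∎
  where
  open Cycle c
  open ≡-Reasoning
  b : Fin (suc K) → Bool
  b = S ∘ vs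

cactus-cut≥2 : ∀ {n m} {ends : Fin m → Fin n × Fin n} → IsCactus ends →
  (S : Fin n → Bool) {u v : Fin n} → S u ≡ true → S v ≡ false → 2 ≤ cutE ends S
cactus-cut≥2 {n} {ends = ends} (connected , _ , cycles) S {u} {v} Su Sv
  with Reachability.reach-crossing ends (λ _ → true) n S (connected u v) Su Sv
... | e , _ , e-crosses with cycles e
... | (c , j , es-j) , _
  with parity-other _ (cycle-crossings-even c S) j (subst (λ x → crosses S (ends x) ≡ true) (sym es-j) e-crosses)
... | j′ , j′≢j , j′-crosses =
  count≥2 (λ x → crosses S (ends x)) (λ es-j′ → j′≢j (Cycle.es-inj c (trans es-j′ (sym es-j)))) j′-crosses e-crosses

split-crossing-≤ : ∀ ca cb ra rb → (ca ≡ true → cb ≡ true → ra ≡ rb) →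
  𝟙 ((ca ∧ ra) xor (cb ∧ rb)) + 𝟙 ((ca ∧ not ra) xor (cb ∧ not rb)) ≤ 𝟙 (ca xor cb)
split-crossing-≤ true  true  ra    rb    same with same refl refl
split-crossing-≤ true  true  true  true  _ | refl = z≤n
split-crossing-≤ true  true  false false _ | refl = z≤n
split-crossing-≤ true  false true  rb    _ = ≤-refl
split-crossing-≤ true  false false rb    _ = ≤-refl
split-crossing-≤ false true  ra    true  _ = ≤-refl
split-crossing-≤ false true  ra    false _ = ≤-refl
split-crossing-≤ false false ra    rb    _ = z≤n

cutE-split : ∀ {n m} (ends : Fin m → Fin n × Fin n) (C R : Fin n → Bool) →
  (∀ e → C (proj₁ (ends e)) ≡ true → C (proj₂ (ends e)) ≡ true → R (proj₁ (ends e)) ≡ R (proj₂ (ends e))) →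
  cutE ends (λ x → C x ∧ R x) + cutE ends (λ x → C x ∧ not (R x)) ≤ cutE ends C
cutE-split ends C R inside = begin
  cutE ends (λ x → C x ∧ R x) + cutE ends (λ x → C x ∧ not (R x))
    ≡⟨ cong₂ _+_ (count≡∑ crossing₁) (count≡∑ crossing₂) ⟩
  sum (𝟙 ∘ crossing₁) + sum (𝟙 ∘ crossing₂)
    ≡⟨ ∑-distrib-+ (𝟙 ∘ crossing₁) (𝟙 ∘ crossing₂) ⟨
  sum (λ e → 𝟙 (crossing₁ e) + 𝟙 (crossing₂ e))
    ≤⟨ ∑-mono _ _ (λ e → split-crossing-≤ _ _ _ _ (inside e)) ⟩
  sum (λ e → 𝟙 (crosses C (ends e)))
    ≡⟨ count≡∑ (λ e → crosses C (ends e)) ⟨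
  cutE ends C ∎
  where
  open ≤-Reasoning
  crossing₁ crossing₂ : _ → Bool
  crossing₁ e = crosses (λ x → C x ∧ R x) (ends e)
  crossing₂ e = crosses (λ x → C x ∧ not (R x)) (ends e)

outside≢ : ∀ {n} {C : Fin n → Bool} {r x} → C r ≡ false → C x ≡ true → x ≢ r
outside≢ Cr Cx refl = contradiction (trans (sym Cx) Cr) λ ()

-- Otherwise C splits into the part reachable from u in G - r and the rest; each part is
-- crossed by at least two edges, and every such edge crosses C.
cut-side-connected : ∀ {n m} {ends : Fin m → Fin n × Fin n} → IsCactus ends → ∀ r {C u v} →
  InCalC ends r C → C u ≡ true → C v ≡ true → reach ends (avoids ends r) n u v ≡ true
cut-side-connected {n} {ends = ends} cactus r {C} {u} {v} (Cr , cut≡2) Cu Cv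
  with reach ends (avoids ends r) n u v in Ruv
... | true  = refl
... | false = contradiction (≤-trans four≤cut (≤-reflexive cut≡2)) λ { (s≤s (s≤s ())) }
  where
  open Reachability ends (avoids ends r)
  Ru = reach ends (avoids ends r) n u
  inside : ∀ e → C (proj₁ (ends e)) ≡ true → C (proj₂ (ends e)) ≡ true → Ru (proj₁ (ends e)) ≡ Ru (proj₂ (ends e))
  inside e Ca Cb = true⇔true⇒≡ (λ Ra → reach-closed e Ra avoids-r (inj₁ (refl , refl)))
                               (λ Rb → reach-closed e Rb avoids-r (inj₂ (refl , refl)))
    where
    avoids-r : avoids ends r e ≡ true
    avoids-r = cong not (cong₂ _∨_ (isNo⇐ (proj₁ (ends e) ≟ r) (outside≢ {C = C} Cr Ca))
                                   (isNo⇐ (proj₂ (ends e) ≟ r) (outside≢ {C = C} Cr Cb)))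
  four≤cut : 4 ≤ cutE ends C
  four≤cut = ≤-trans
    (+-mono-≤ (cactus-cut≥2 cactus (λ x → C x ∧ Ru x) {u} (∧-intro Cu (reach-refl n u)) (cong (_∧ Ru r) Cr))
              (cactus-cut≥2 cactus (λ x → C x ∧ not (Ru x)) {v} (∧-intro Cv (cong not Ruv)) (cong (_∧ not (Ru r)) Cr)))
    (cutE-split ends C Ru inside)

isEnd-proj₁ : ∀ {n} (q : Fin n × Fin n) → isEnd q (proj₁ q) ≡ true
isEnd-proj₁ (a , b) = ∨-introˡ _ (==-refl a)

isEnd-proj₂ : ∀ {n} (q : Fin n × Fin n) → isEnd q (proj₂ q) ≡ true
isEnd-proj₂ (a , b) = ∨-introʳ (a == b) (==-refl b)

isEnd⇒ : ∀ {n} (q : Fin n × Fin n) {w} → isEnd q w ≡ true → proj₁ q ≡ w ⊎ proj₂ q ≡ w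
isEnd⇒ (a , b) e with ∨-true (a == _) (b == _) e
... | inj₁ a=w = inj₁ (==⇒≡ a=w)
... | inj₂ b=w = inj₂ (==⇒≡ b=w)

crosses⇒inner-end : ∀ {n} (S : Fin n → Bool) (q : Fin n × Fin n) → crosses S q ≡ true →
  ∃ λ w → S w ≡ true × isEnd q w ≡ true
crosses⇒inner-end S (a , b) c with xor-true (S a) (S b) c
... | inj₁ (Sa , _) = a , Sa , isEnd-proj₁ (a , b)
... | inj₂ (_ , Sb) = b , Sb , isEnd-proj₂ (a , b)

crosses⇒outer-end : ∀ {n} (S : Fin n → Bool) (q : Fin n × Fin n) → crosses S q ≡ true → ∃ λ w → S w ≡ false
crosses⇒outer-end S (a , b) c with xor-true (S a) (S b) c
... | inj₁ (_ , Sb) = b , Sb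
... | inj₂ (Sa , _) = a , Sa

crosses-cong : ∀ {n} {S S′ : Fin n → Bool} → S ≗ S′ → ∀ q → crosses S q ≡ crosses S′ q
crosses-cong S≗S′ (a , b) = cong₂ _xor_ (S≗S′ a) (S≗S′ b)

module Instance {n m p : ℕ} (ends : Fin m → Fin n × Fin n) (lk : Fin p → Fin n × Fin n) (r : Fin n) where

  A B : Fin p → Fin n
  A l = proj₁ (lk l)
  B l = proj₂ (lk l)

  degree : (Fin p → Bool) → Fin n → ℕ
  degree X w = count (λ j → X j ∧ isEnd (lk j) w)

  covered : (Fin p → Bool) → Fin n → Bool
  covered X w = anyFin (λ j → X j ∧ isEnd (lk j) w)

  numOut : (Fin p → Bool) → ℕ
  numOut X = count (λ i → X i ∧ not (isInLink ends lk r i))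

  GoodMatching : (Fin p → Bool) → Set
  GoodMatching X = IsLeafMatching ends lk X × (∀ i → X i ≡ true → ¬ IsBad ends lk r i)

  BadCut : Fin p → (Fin n → Bool) → Set
  BadCut l C = InCalC ends r C × (∀ w → InTC ends lk C w → w ≡ A l ⊎ w ≡ B l) × C (A l) ≡ true × C (B l) ≡ true

  InTC? : ∀ C w → Dec (InTC ends lk C w)
  InTC? C w = (isLeaf ends w Bool.≟ true) ×-dec (C w Bool.≟ true) ×-dec
              any? (λ j → (crosses C (lk j) Bool.≟ true) ×-dec (isEnd (lk j) w Bool.≟ true))

  BadCut? : ∀ l → U.Decidable (BadCut l)
  BadCut? l C = ((C r Bool.≟ false) ×-dec (cutE ends C ℕ.≟ 2)) ×-dec
                all? (λ w → InTC? C w →-dec ((w ≟ A l) ⊎-dec (w ≟ B l))) ×-dec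
                (C (A l) Bool.≟ true) ×-dec (C (B l) Bool.≟ true)

  BadCut-resp : ∀ l → Respects≗ (BadCut l)
  BadCut-resp l C≗C′ ((Cr , cut) , T⊆ , CA , CB) =
    (trans (sym (C≗C′ r)) Cr , trans (sym (count-cong (crosses-cong C≗C′ ∘ ends))) cut) ,
    (λ w (leaf , C′w , j , crosses-j , end-j) →
       T⊆ w (leaf , trans (C≗C′ w) C′w , j , trans (crosses-cong C≗C′ (lk j)) crosses-j , end-j)) ,
    trans (sym (C≗C′ (A l))) CA , trans (sym (C≗C′ (B l))) CB

  IsBad? : ∀ l → Dec (IsBad ends lk r l)
  IsBad? l = ∃? (BadCut-resp l) (BadCut? l)

  GoodMatching? : U.Decidable GoodMatching
  GoodMatching? X =
    (all? (λ i → (X i Bool.≟ true) →-dec ((isLeaf ends (A i) Bool.≟ true) ×-dec (isLeaf ends (B i) Bool.≟ true))) ×-dec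
     all? (λ i → all? (λ j → (X i Bool.≟ true) →-dec (X j Bool.≟ true) →-dec ¬? (i ≟ j) →-dec
       all? (λ v → (isEnd (lk i) v Bool.≟ true) →-dec (isEnd (lk j) v Bool.≟ false))))) ×-dec
    all? (λ i → (X i Bool.≟ true) →-dec ¬? (IsBad? i))

  GoodMatching-resp : Respects≗ GoodMatching
  GoodMatching-resp X≗Y ((leaves , disjoint) , good) =
    ((λ i Yi → leaves i (trans (X≗Y i) Yi)) , (λ i j Yi Yj → disjoint i j (trans (X≗Y i) Yi) (trans (X≗Y j) Yj))) ,
    (λ i Yi → good i (trans (X≗Y i) Yi))

  -- 2|X| - |X_in|, written without truncated subtraction.
  weight : (Fin p → Bool) → ℕ
  weight X = count X + numOut X

  empty-good : GoodMatching (λ _ → false)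
  empty-good = ((λ _ ()) , (λ _ _ ())) , (λ _ ())

  heaviest-good-matching : Maximum GoodMatching weight
  heaviest-good-matching with maximum GoodMatching-resp GoodMatching? weight weight-inv
    where
    weight-inv : Invariant≗ weight
    weight-inv X≗Y = cong₂ _+_ (count-cong X≗Y) (count-cong (λ i → cong (_∧ _) (X≗Y i)))
  ... | inj₁ heaviest = heaviest
  ... | inj₂ none     = contradiction empty-good (none (λ _ → false))

  largest-good-matching-in : (H : Fin p → Bool) → Maximum (λ X → GoodMatching X × X ⊆ H) count
  largest-good-matching-in H with maximum resp good⊆H? count count-cong
    where
    good⊆H? : U.Decidable (λ X → GoodMatching X × X ⊆ H)
    good⊆H? X = GoodMatching? X ×-dec all? (λ i → (X i Bool.≟ true) →-dec (H i Bool.≟ true))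
    resp : Respects≗ (λ X → GoodMatching X × X ⊆ H)
    resp X≗Y (good , X⊆H) = GoodMatching-resp X≗Y good , (λ i Yi → X⊆H i (trans (X≗Y i) Yi))
  ... | inj₁ largest = largest
  ... | inj₂ none    = contradiction (empty-good , (λ _ ())) (none (λ _ → false))

  insert : Fin p → (Fin p → Bool) → (Fin p → Bool)
  insert l X i = X i ∨ (i == l)

  covers : ∀ {X w} j → X j ≡ true → isEnd (lk j) w ≡ true → covered X w ≡ true
  covers j Xj end = anyFin-intro _ {j} (∧-intro Xj end)

  uncovered : ∀ {X w} → covered X w ≡ false → ∀ j → X j ≡ true → isEnd (lk j) w ≡ false
  uncovered c j Xj = ¬-not λ end → contradiction (trans (sym (covers j Xj end)) c) λ ()

  unmatched : ∀ {X w j} → covered X w ≡ false → isEnd (lk j) w ≡ true → X j ≡ false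
  unmatched {j = j} c end = ¬-not λ Xj → contradiction (trans (sym (covers j Xj end)) c) λ ()

  good-insert : ∀ {X l} → GoodMatching X → isLeaf ends (A l) ≡ true → isLeaf ends (B l) ≡ true →
    covered X (A l) ≡ false → covered X (B l) ≡ false → ¬ IsBad ends lk r l → GoodMatching (insert l X)
  good-insert {X} {l} ((leaves , disjoint) , good) leafA leafB freeA freeB ¬bad = (leaves′ , disjoint′) , good′
    where
    free-end : ∀ {w} → isEnd (lk l) w ≡ true → covered X w ≡ false
    free-end e with isEnd⇒ (lk l) e
    ... | inj₁ refl = freeA
    ... | inj₂ refl = freeB
    cases : ∀ {i} → insert l X i ≡ true → X i ≡ true ⊎ i ≡ l
    cases {i} e with ∨-true (X i) (i == l) e
    ... | inj₁ Xi  = inj₁ Xi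
    ... | inj₂ i=l = inj₂ (==⇒≡ i=l)
    leaves′ : ∀ i → insert l X i ≡ true → isLeaf ends (A i) ≡ true × isLeaf ends (B i) ≡ true
    leaves′ i e with cases e
    ... | inj₁ Xi   = leaves i Xi
    ... | inj₂ refl = leafA , leafB
    disjoint′ : ∀ i j → insert l X i ≡ true → insert l X j ≡ true → i ≢ j →
      ∀ v → isEnd (lk i) v ≡ true → isEnd (lk j) v ≡ false
    disjoint′ i j ei ej i≢j v vi with cases ei | cases ej
    ... | inj₁ Xi   | inj₁ Xj   = disjoint i j Xi Xj i≢j v vi
    ... | inj₂ refl | inj₁ Xj   = uncovered (free-end vi) j Xj
    ... | inj₁ Xi   | inj₂ refl = ¬-not λ vl → contradiction (trans (sym (covers i Xi vi)) (free-end vl)) λ ()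
    ... | inj₂ refl | inj₂ refl = contradiction refl i≢j
    good′ : ∀ i → insert l X i ≡ true → ¬ IsBad ends lk r i
    good′ i e with cases e
    ... | inj₁ Xi   = good i Xi
    ... | inj₂ refl = ¬bad

  solution-crosses-2-cut : ∀ {H C u v} → IsSolution ends lk H → cutE ends C ≡ 2 → C u ≡ true → C v ≡ false →
    ∃ λ j → H j ∧ crosses C (lk j) ≡ true
  solution-crosses-2-cut {H} {C} {u} {v} sol cut≡2 Cu Cv = count-pos⇒∃ _
    (+-cancelˡ-≤ 2 1 _ (subst (λ c → 3 ≤ c + cutL lk H C) cut≡2 (sol C (u , Cu) (v , Cv))))

  solution-covers-leaves : Loopless ends → ∀ {H t} → IsSolution ends lk H → isLeaf ends t ≡ true →
    ∃ λ l → H l ∧ isEnd (lk l) t ≡ true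
  solution-covers-leaves loopless {H} {t} sol leaf =
    l , ∧-intro (∧-conicalˡ (H l) _ Hl-crosses) (xor⇒∨ (S (A l)) (S (B l)) (∧-conicalʳ (H l) _ Hl-crosses))
    where
    S : Fin n → Bool
    S v = v == t
    no-loop : ∀ e → ¬ ((proj₁ (ends e) == t) ≡ true × (proj₂ (ends e) == t) ≡ true)
    no-loop e (a=t , b=t) = loopless e (trans (==⇒≡ a=t) (sym (==⇒≡ b=t)))
    cut≡2 : cutE ends S ≡ 2
    cut≡2 = trans (count-cong (λ e → xor≡∨ _ _ (no-loop e))) (isYes⇒ (deg ends t ℕ.≟ 2) leaf)
    outside : ∃ λ v → S v ≡ false
    outside = let e , e-crosses = count-pos⇒∃ _ (subst (1 ≤_) (sym cut≡2) (s≤s z≤n))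
              in crosses⇒outer-end S (ends e) e-crosses
    link : ∃ λ l → H l ∧ crosses S (lk l) ≡ true
    link = solution-crosses-2-cut {C = S} sol cut≡2 (==-refl t) (proj₂ outside)
    l = proj₁ link
    Hl-crosses : H l ∧ crosses S (lk l) ≡ true
    Hl-crosses = proj₂ link

  link-end-leaf : LeafToLeafPlus ends lk r → ∀ {j w} → isEnd (lk j) w ≡ true → w ≢ r → isLeaf ends w ≡ true
  link-end-leaf leaf-ends {j} end w≢r with isEnd⇒ (lk j) end | leaf-ends j
  ... | inj₁ refl | inj₁ A=r , _ = contradiction A=r w≢r
  ... | inj₁ refl | inj₂ leaf , _ = leaf
  ... | inj₂ refl | _ , inj₁ B=r = contradiction B=r w≢r
  ... | inj₂ refl | _ , inj₂ leaf = leaf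

  bad⇒in-link : IsCactus ends → ∀ {l} → IsBad ends lk r l → isInLink ends lk r l ≡ true
  bad⇒in-link cactus {l} (C , inC@(Cr , _) , _ , CA , CB) =
    ∧-intro (cong not (isNo⇐ (A l ≟ r) (outside≢ {C = C} Cr CA)))
      (∧-intro (cong not (isNo⇐ (B l ≟ r) (outside≢ {C = C} Cr CB))) (cut-side-connected cactus r inC CA CB))

  bad-link-busy-end : LeafToLeafPlus ends lk r → ∀ {H l} → IsSolution ends lk H → H l ≡ true → IsBad ends lk r l →
    1 < degree H (A l) ⊎ 1 < degree H (B l)
  bad-link-busy-end leaf-ends {H} {l} sol Hl (C , (Cr , cut≡2) , T⊆ , CA , CB) =
    Sum.map (λ w≡A → busy w≡A (isEnd-proj₁ (lk l))) (λ w≡B → busy w≡B (isEnd-proj₂ (lk l)))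
      (T⊆ w (link-end-leaf leaf-ends end-j (outside≢ {C = C} Cr Cw) , Cw , j , crosses-j , end-j))
    where
    crossing : ∃ λ j → H j ∧ crosses C (lk j) ≡ true
    crossing = solution-crosses-2-cut {C = C} sol cut≡2 CA Cr
    j = proj₁ crossing
    crosses-j = ∧-conicalʳ _ _ (proj₂ crossing)
    inner-end = crosses⇒inner-end C (lk j) crosses-j
    w = proj₁ inner-end
    Cw = proj₁ (proj₂ inner-end)
    end-j = proj₂ (proj₂ inner-end)
    j≢l : j ≢ l
    j≢l j≡l = contradiction (trans (sym crosses-j) (trans (cong (crosses C ∘ lk) j≡l) (cong₂ _xor_ CA CB))) λ ()
    busy : ∀ {x} → w ≡ x → isEnd (lk l) x ≡ true → 1 < degree H x
    busy refl end-l = count≥2 _ j≢l (∧-intro (∧-conicalˡ _ _ (proj₂ crossing)) end-j) (∧-intro Hl end-l)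

-- Charging

share : (matched inH free lonely : Bool) → ℕ
share matched inH free lonely = if matched then 2 else if inH ∧ free then (if lonely then 2 else 1) else 0

share≤2 : ∀ m h f d → share m h f d ≤ 2
share≤2 true  h     f     d     = ≤-refl
share≤2 false true  true  true  = ≤-refl
share≤2 false true  true  false = s≤s z≤n
share≤2 false true  false d     = z≤n
share≤2 false false f     d     = z≤n

2≤budget : ∀ i → 2 ≤ 2 * 1 + 𝟙 (true ∧ i) + (𝟙 false + 𝟙 (false ∧ not i))
2≤budget true  = s≤s (s≤s z≤n)
2≤budget false = s≤s (s≤s z≤n)

share-bound : ∀ m h i fa fb da db → (m ≡ true → h ≡ true) →
  (h ≡ true → m ≡ false → fa ≡ true → fb ≡ true → i ≡ true × da ∧ db ≡ false) →
  share m h fa da + share m h fb db ≤ 2 * 𝟙 h + 𝟙 (h ∧ i) + (𝟙 m + 𝟙 (m ∧ not i))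
share-bound true  true  true  fa    fb    da    db    _   _ = ≤-refl
share-bound true  true  false fa    fb    da    db    _   _ = ≤-refl
share-bound true  false i     fa    fb    da    db    m⇒h _ = contradiction (m⇒h refl) λ ()
share-bound false false i     fa    fb    da    db    _   _ = z≤n
share-bound false true  i     false fb    da    db    _   _ = ≤-trans (share≤2 false true fb db) (2≤budget i)
share-bound false true  i     true  false da    db    _   _ =
  ≤-trans (≤-reflexive (+-identityʳ _)) (≤-trans (share≤2 false true true da) (2≤budget i))
share-bound false true  i     true  true  da    db    _   forced with forced refl refl refl refl
... | refl , not-both = lonely-pair≤3 da db not-both
  where
  lonely-pair≤3 : ∀ da db → da ∧ db ≡ false → (if da then 2 else 1) + (if db then 2 else 1) ≤ 3
  lonely-pair≤3 true  false _ = ≤-refl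
  lonely-pair≤3 false true  _ = ≤-refl
  lonely-pair≤3 false false _ = s≤s (s≤s z≤n)

module Charging {n m p : ℕ} {ends : Fin m → Fin n × Fin n} {lk : Fin p → Fin n × Fin n} {r : Fin n}
  (cactus : IsCactus ends) (leaf-ends : LeafToLeafPlus ends lk r)
  {H M : Fin p → Bool} (solution : IsSolution ends lk H) (M-good : Instance.GoodMatching ends lk r M) (M⊆H : M ⊆ H)
  (M-max : ∀ X → Instance.GoodMatching ends lk r X → X ⊆ H → count X ≤ count M) where

  open Instance ends lk r

  inLink : Fin p → Bool
  inLink = isInLink ends lk r

  free : Fin n → Bool
  free w = isLeaf ends w ∧ not (covered M w)

  lonely : Fin n → Bool
  lonely w = ⌊ degree H w ℕ.≟ 1 ⌋

  charge : Fin p → Fin n → ℕ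
  charge l w = share (M l) (H l) (free w) (lonely w)

  summand : Fin n → Fin p → ℕ
  summand w l = if isEnd (lk l) w then charge l w else 0

  received : Fin n → ℕ
  received w = sum (summand w)

  free-link-bad : ∀ {l} → H l ≡ true → free (A l) ≡ true → free (B l) ≡ true → IsBad ends lk r l
  free-link-bad {l} Hl freeA freeB with IsBad? l
  ... | yes bad = bad
  ... | no ¬bad = contradiction (M-max (insert l M) augmented augmented⊆H) (<⇒≱ grows)
    where
    uncoveredA = Bool.not-injective (∧-conicalʳ _ _ freeA)
    uncoveredB = Bool.not-injective (∧-conicalʳ _ _ freeB)
    augmented : GoodMatching (insert l M)
    augmented = good-insert M-good (∧-conicalˡ _ _ freeA) (∧-conicalˡ _ _ freeB) uncoveredA uncoveredB ¬bad
    augmented⊆H : insert l M ⊆ H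
    augmented⊆H i e with ∨-true (M i) (i == l) e
    ... | inj₁ Mi  = M⊆H i Mi
    ... | inj₂ i=l = subst (λ j → H j ≡ true) (sym (==⇒≡ i=l)) Hl
    grows : count M < count (insert l M)
    grows = count-mono-< (λ i Mi → ∨-introˡ _ Mi) l
      (unmatched uncoveredA (isEnd-proj₁ (lk l))) (∨-introʳ (M l) (==-refl l))

  summand-end : ∀ {l w} → isEnd (lk l) w ≡ true → summand w l ≡ charge l w
  summand-end {l} {w} end = cong (λ b → if b then charge l w else 0) end

  free-charge : ∀ {l w} → H l ≡ true → M l ≡ false → free w ≡ true → charge l w ≡ (if lonely w then 2 else 1)
  free-charge Hl Ml fw rewrite Hl | Ml | fw = refl

  matched-charge : ∀ {l w} → M l ≡ true → charge l w ≡ 2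
  matched-charge Ml rewrite Ml = refl

  free-summand : ∀ {j w} → free w ≡ true → H j ∧ isEnd (lk j) w ≡ true → summand w j ≡ (if lonely w then 2 else 1)
  free-summand fw Hj-end =
    trans (summand-end end)
      (free-charge (∧-conicalˡ _ _ Hj-end) (unmatched (Bool.not-injective (∧-conicalʳ _ _ fw)) end) fw)
    where
    end = ∧-conicalʳ _ _ Hj-end

  free-received : ∀ {t} → free t ≡ true → 2 ≤ received t
  free-received {t} ft = by-lonely (lonely t) refl
    where
    covering : ∃ λ l → H l ∧ isEnd (lk l) t ≡ true
    covering = solution-covers-leaves (proj₁ (proj₂ cactus)) solution (∧-conicalˡ _ _ ft)
    l = proj₁ covering
    Hl-end = proj₂ covering
    by-lonely : ∀ b → lonely t ≡ b → 2 ≤ received t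
    by-lonely true lonely-t =
      subst (_≤ received t) (trans (free-summand ft Hl-end) (cong (λ b → if b then 2 else 1) lonely-t))
        (∑-term (summand t) l)
    by-lonely false lonely-t =
      subst (_≤ received t) (cong₂ _+_ (once Hl-end) (once Hl₂-end)) (∑-two-terms (summand t) (l₂≢l ∘ sym))
      where
      once : ∀ {j} → H j ∧ isEnd (lk j) t ≡ true → summand t j ≡ 1
      once Hj-end = trans (free-summand ft Hj-end) (cong (λ b → if b then 2 else 1) lonely-t)
      busy : 1 < degree H t
      busy = ≤∧≢⇒< (count-pos (λ j → H j ∧ isEnd (lk j) t) Hl-end)
                   (λ 1≡deg → isNo⇒ (degree H t ℕ.≟ 1) lonely-t (sym 1≡deg))
      other : ∃ λ l₂ → l₂ ≢ l × H l₂ ∧ isEnd (lk l₂) t ≡ true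
      other = count≥2⇒∃≢ _ busy l
      l₂ = proj₁ other
      l₂≢l = proj₁ (proj₂ other)
      Hl₂-end = proj₂ (proj₂ other)

  leaf-received : ∀ {t} → isLeaf ends t ≡ true → 2 ≤ received t
  leaf-received {t} leaf = by-covered (covered M t) refl
    where
    by-covered : ∀ b → covered M t ≡ b → 2 ≤ received t
    by-covered false cov = free-received (∧-intro leaf (cong not cov))
    by-covered true  cov =
      subst (_≤ received t) (trans (summand-end (∧-conicalʳ _ _ Mj-end)) (matched-charge (∧-conicalˡ _ _ Mj-end)))
        (∑-term (summand t) j)
      where
      matching-link : ∃ λ j → M j ∧ isEnd (lk j) t ≡ true
      matching-link = anyFin⇒∃ _ cov
      j = proj₁ matching-link
      Mj-end = proj₂ matching-link

  budget : Fin p → ℕ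
  budget l = 2 * 𝟙 (H l) + 𝟙 (H l ∧ inLink l) + (𝟙 (M l) + 𝟙 (M l ∧ not (inLink l)))

  link-sends : ∀ l → charge l (A l) + charge l (B l) ≤ budget l
  link-sends l = share-bound (M l) (H l) (inLink l) (free (A l)) (free (B l)) (lonely (A l)) (lonely (B l)) (M⊆H l) forced
    where
    not-both-lonely : 1 < degree H (A l) ⊎ 1 < degree H (B l) → lonely (A l) ∧ lonely (B l) ≡ false
    not-both-lonely (inj₁ busy) = cong (_∧ lonely (B l)) (isNo⇐ (degree H (A l) ℕ.≟ 1) (>⇒≢ busy))
    not-both-lonely (inj₂ busy) =
      trans (cong (lonely (A l) ∧_) (isNo⇐ (degree H (B l) ℕ.≟ 1) (>⇒≢ busy))) (Bool.∧-zeroʳ (lonely (A l)))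
    forced : H l ≡ true → M l ≡ false → free (A l) ≡ true → free (B l) ≡ true →
      inLink l ≡ true × lonely (A l) ∧ lonely (B l) ≡ false
    forced Hl _ freeA freeB = bad⇒in-link cactus bad , not-both-lonely (bad-link-busy-end leaf-ends solution Hl bad)
      where
      bad = free-link-bad Hl freeA freeB

  budget-sum : sum budget ≡ 2 * count H + numIn ends lk r H + (count M + numOut M)
  budget-sum = begin
    sum budget
      ≡⟨ ∑-distrib-+ (λ l → 2 * 𝟙 (H l) + 𝟙 (H l ∧ inLink l)) (λ l → 𝟙 (M l) + 𝟙 (M l ∧ not (inLink l))) ⟩
    sum (λ l → 2 * 𝟙 (H l) + 𝟙 (H l ∧ inLink l)) + sum (λ l → 𝟙 (M l) + 𝟙 (M l ∧ not (inLink l)))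
      ≡⟨ cong₂ _+_ (∑-distrib-+ (λ l → 2 * 𝟙 (H l)) (λ l → 𝟙 (H l ∧ inLink l)))
                   (∑-distrib-+ (λ l → 𝟙 (M l)) (λ l → 𝟙 (M l ∧ not (inLink l)))) ⟩
    sum (λ l → 2 * 𝟙 (H l)) + sum (λ l → 𝟙 (H l ∧ inLink l))
      + (sum (𝟙 ∘ M) + sum (λ l → 𝟙 (M l ∧ not (inLink l))))
      ≡⟨ cong₂ _+_ (cong₂ _+_ (trans (cong (2 *_) (count≡∑ H)) (*-distribˡ-sum 2 (𝟙 ∘ H)))
                              (count≡∑ (λ l → H l ∧ inLink l)))
                   (cong₂ _+_ (count≡∑ M) (count≡∑ (λ l → M l ∧ not (inLink l)))) ⟨
    2 * count H + numIn ends lk r H + (count M + numOut M) ∎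
    where open ≡-Reasoning

  charging-bound : 2 * numLeaves ends ≤ 2 * count H + numIn ends lk r H + (count M + numOut M)
  charging-bound = begin
    2 * numLeaves ends                          ≡⟨ cong (2 *_) (count≡∑ (isLeaf ends)) ⟩
    2 * sum (𝟙 ∘ isLeaf ends)                   ≡⟨ *-distribˡ-sum 2 (𝟙 ∘ isLeaf ends) ⟩
    sum (λ t → 2 * 𝟙 (isLeaf ends t))           ≤⟨ ∑-mono _ _ leaf-bound ⟩
    sum received                                ≡⟨ ∑-comm summand ⟩
    sum (λ l → sum (λ t → summand t l))         ≤⟨ ∑-mono _ _ (λ l → ∑-endpoints (A l) (B l) (charge l)) ⟩
    sum (λ l → charge l (A l) + charge l (B l)) ≤⟨ ∑-mono _ _ link-sends ⟩
    sum budget                                  ≡⟨ budget-sum ⟩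
    2 * count H + numIn ends lk r H + (count M + numOut M) ∎
    where
    open ≤-Reasoning
    leaf-bound : ∀ t → 2 * 𝟙 (isLeaf ends t) ≤ received t
    leaf-bound t = by-leaf (isLeaf ends t) refl
      where
      by-leaf : ∀ b → isLeaf ends t ≡ b → 2 * 𝟙 b ≤ received t
      by-leaf true  leaf = leaf-received leaf
      by-leaf false _    = z≤n

module _ {n m p : ℕ} {ends : Fin m → Fin n × Fin n} {lk : Fin p → Fin n × Fin n} {r : Fin n}
  (cactus : IsCactus ends) (leaf-ends : LeafToLeafPlus ends lk r) where

  open Instance ends lk r

  leaves-≤-solution+heaviest : ∀ {H M} → IsSolution ends lk H → (∀ X → GoodMatching X → weight X ≤ weight M) →
    2 * numLeaves ends ≤ 2 * count H + numIn ends lk r H + weight M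
  leaves-≤-solution+heaviest {H} solution M-heaviest with largest-good-matching-in H
  ... | M′ , (M′-good , M′⊆H) , M′-largest = ≤-trans
    (Charging.charging-bound cactus leaf-ends solution M′-good M′⊆H (λ X good X⊆H → M′-largest X (good , X⊆H)))
    (+-monoʳ-≤ (2 * count H + numIn ends lk r H) (M-heaviest M′ M′-good))

doubled-bound : ∀ {c i o t h} → c ≡ i + o → t ≤ h + (c + o) → 2 * c + i + t ≤ h + 4 * c
doubled-bound {i = i} {o} {h = h} refl t≤ = ≤-trans (+-monoʳ-≤ (2 * (i + o) + i) t≤) (≤-reflexive (rearrange i o h))
  where
  rearrange : ∀ i o h → 2 * (i + o) + i + (h + (i + o + o)) ≡ h + 4 * (i + o)
  rearrange = solve-∀

-- The argument never uses that links are distinct.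
lemma10 : ∀ {n m p : ℕ} (ends : Fin m → Fin n × Fin n) (lk : Fin p → Fin n × Fin n) (r : Fin n) →
    IsCactus ends → IsLinkSet lk → LeafToLeafPlus ends lk r →
    Σ (Fin p → Bool) (λ M →
      IsLeafMatching ends lk M ×
      (∀ i → M i ≡ true → ¬ IsBad ends lk r i) ×
      (∀ (H : Fin p → Bool) → IsSolution ends lk H →
        2 * count M + numIn ends lk r M + 2 * numLeaves ends
          ≤ 2 * count H + numIn ends lk r H + 4 * count M))
lemma10 ends lk r cactus _ leaf-ends with Instance.heaviest-good-matching ends lk r
... | M , (matching , no-bad-link) , M-heaviest = M , matching , no-bad-link , λ H solution →
  doubled-bound {h = 2 * count H + numIn ends lk r H} (count-split M (isInLink ends lk r))
    (leaves-≤-solution+heaviest cactus leaf-ends solution M-heaviest)
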